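{- For every nonnegative integer $n$, \[ H_n(x)=n!\sum_{k=0}^{n}\Biggl((k+1)\sum_{\substack{0\le l\le n-k\\ l\equiv 0 \ (\mathrm{mod}\ 2)}}\frac{H_{n-k-l}}{(n-k-l)!\left(\frac{2k+l+2}{2}\right)!\left(\frac{l}{2}\right)!}\Biggr)U_k(x). \]
   Context: The Hermite polynomials $H_m(x)$ are defined by $e^{2xt-t^2}=\sum_{m\ge0}H_m(x)\frac{t^m}{m!}$, and the Hermite numbers are $H_m=H_m(0)$. $U_k(x)$ denotes the Chebyshev polynomial of the second kind, defined by $U_k(\cos\theta)=\frac{\sin((k+1)\theta)}{\sin\theta}$. -}

module Defs where

open import Data.Nat as ℕ using (ℕ; zero; suc; _!; _∸_; ⌊_/2⌋)
open import Data.Nat.Properties using (_!≢0)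
open import Data.Integer as ℤ using (+_)
open import Data.Rational using (ℚ; _+_; _*_; _-_; -_; _/_; 0ℚ; 1ℚ)

ℕ→ℚ : ℕ → ℚ
ℕ→ℚ n = (+ n) / 1

infixr 8 _^_
_^_ : ℚ → ℕ → ℚ
q ^ zero  = 1ℚ
q ^ suc n = q * (q ^ n)

invFact : ℕ → ℚ
invFact n = ((+ 1) / (n !)) {{n !≢0}}

sumTo : ℕ → (ℕ → ℚ) → ℚ
sumTo zero    f = f 0
sumTo (suc n) f = sumTo n f + f (suc n)

-- Hermite polynomial H_m(x), defined by e^{2xt - t^2} = Σ H_m(x) t^m / m!.
-- Writing e^{2xt - t^2} = e^{2xt} · e^{-t^2} and taking the Cauchy product,
-- the coefficient of t^m/m! is  m! Σ_{j ≤ m/2} (-1)^j (2x)^{m-2j} / (j! (m-2j)!).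
hermite : ℕ → ℚ → ℚ
hermite m x =
  ℕ→ℚ (m !) * sumTo ⌊ m /2⌋ (λ j →
    ((- 1ℚ) ^ j) * ((ℕ→ℚ 2 * x) ^ (m ∸ (2 ℕ.* j))) * invFact j * invFact (m ∸ (2 ℕ.* j)))

hermiteNum : ℕ → ℚ
hermiteNum m = hermite m 0ℚ

-- Chebyshev polynomials of the second kind, via the standard recurrence
-- U_0 = 1, U_1 = 2x, U_{k+2} = 2x U_{k+1} - U_k
-- (equivalent to U_k(cos θ) = sin((k+1)θ)/sin θ).
chebU : ℕ → ℚ → ℚ
chebU zero          x = 1ℚ
chebU (suc zero)    x = ℕ→ℚ 2 * x
chebU (suc (suc k)) x = ℕ→ℚ 2 * x * chebU (suc k) x - chebU k x

-- Inner sum over even l = 2j with 0 ≤ l ≤ n - k: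
--   Σ H_{n-k-l} / ((n-k-l)! ((2k+l+2)/2)! (l/2)!)
innerSum : ℕ → ℕ → ℚ
innerSum n k = sumTo ⌊ (n ∸ k) /2⌋ (λ j →
  hermiteNum (n ∸ k ∸ (2 ℕ.* j)) * invFact (n ∸ k ∸ (2 ℕ.* j))
    * invFact (k ℕ.+ j ℕ.+ 1) * invFact j)

rhs : ℕ → ℚ → ℚ
rhs n x = ℕ→ℚ (n !) * sumTo n (λ k → (ℕ→ℚ (k ℕ.+ 1) * innerSum n k) * chebU k x)

{-# OPTIONS --safe #-}
-- Splitting e^(2xt − t²) = e^(2xt) · e^(−t²) gives
-- H_n(x)/n! = Σ_i (H_(n−i)/(n−i)!) · (2x)^i/i!, where H_m/m! is (−1)^j/j! for m = 2j and 0 for odd m.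
-- In the Chebyshev basis (2x)^i/i! = Σ_(k+2j=i) (k+1)/((k+j+1)! j!) · U_k(x): multiplying by 2x
-- and using 2x U_k = U_(k+1) + U_(k−1) turns the expansion of degree i into that of degree i+1,
-- because these coefficients c(k,j) satisfy (k+2j) c(k,j) = c(k−1,j) + c(k+1,j−1).
-- Substituting and exchanging the two sums collects the coefficient of each U_k(x).
module Submission where

open import Defs
open import Data.Nat using (ℕ)
open import Data.Rational using (ℚ)
open import Relation.Binary.PropositionalEquality using (_≡_)

open import Data.Nat.Base as ℕ using (zero; suc; _!; ⌊_/2⌋; _∸_; _≤_; _<_; z≤n; s≤s; NonZero)
import Data.Nat.Properties as ℕₚ
open import Data.Integer.Base as ℤ using (+_)
import Data.Integer.Properties as ℤₚ
import Data.Integer.Tactic.RingSolver as ℤ-Solver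
open import Data.Rational.Base using (_+_; _*_; _-_; -_; _/_; 0ℚ; 1ℚ; toℚᵘ)
import Data.Rational.Properties as ℚₚ
open import Data.Rational.Unnormalised.Base as ℚᵘ using (mkℚᵘ; *≡*)
import Data.Rational.Unnormalised.Properties as ℚᵘₚ
open import Relation.Binary.PropositionalEquality
  using (refl; sym; trans; cong; cong₂; subst; module ≡-Reasoning)
open import Relation.Nullary.Decidable.Core using (dec⇒maybe)
open import Level using (0ℓ)
open import Tactic.RingSolver using (solve-∀)
import Tactic.RingSolver.Core.AlmostCommutativeRing as ACR

ℚ-ring : ACR.AlmostCommutativeRing 0ℓ 0ℓ
ℚ-ring = ACR.fromCommutativeRing ℚₚ.+-*-commutativeRing (λ q → dec⇒maybe (0ℚ ℚₚ.≟ q))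

module _ where
  open ℚᵘₚ.≃-Reasoning

  private
    toℚᵘ-ℕ→ℚ : ∀ m → toℚᵘ (ℕ→ℚ m) ℚᵘ.≃ mkℚᵘ (+ m) 0
    toℚᵘ-ℕ→ℚ m = ℚₚ.toℚᵘ-fromℚᵘ (mkℚᵘ (+ m) 0)

  ℕ→ℚ-+ : ∀ m n → ℕ→ℚ (m ℕ.+ n) ≡ ℕ→ℚ m + ℕ→ℚ n
  ℕ→ℚ-+ m n = ℚₚ.toℚᵘ-injective (begin
    toℚᵘ (ℕ→ℚ (m ℕ.+ n))             ≈⟨ toℚᵘ-ℕ→ℚ (m ℕ.+ n) ⟩
    mkℚᵘ (+ (m ℕ.+ n)) 0              ≈⟨ *≡* (trans (cong (ℤ._* + 1) (ℤₚ.pos-+ m n)) (ℤ-identity (+ m) (+ n))) ⟩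
    mkℚᵘ (+ m) 0 ℚᵘ.+ mkℚᵘ (+ n) 0    ≈⟨ ℚᵘₚ.+-cong (toℚᵘ-ℕ→ℚ m) (toℚᵘ-ℕ→ℚ n) ⟨
    toℚᵘ (ℕ→ℚ m) ℚᵘ.+ toℚᵘ (ℕ→ℚ n)   ≈⟨ ℚₚ.toℚᵘ-homo-+ (ℕ→ℚ m) (ℕ→ℚ n) ⟨
    toℚᵘ (ℕ→ℚ m + ℕ→ℚ n)             ∎)
    where
    ℤ-identity : ∀ a b → (a ℤ.+ b) ℤ.* + 1 ≡ (a ℤ.* + 1 ℤ.+ b ℤ.* + 1) ℤ.* + 1
    ℤ-identity = ℤ-Solver.solve-∀

  ℕ→ℚ-* : ∀ m n → ℕ→ℚ (m ℕ.* n) ≡ ℕ→ℚ m * ℕ→ℚ n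
  ℕ→ℚ-* m n = ℚₚ.toℚᵘ-injective (begin
    toℚᵘ (ℕ→ℚ (m ℕ.* n))             ≈⟨ toℚᵘ-ℕ→ℚ (m ℕ.* n) ⟩
    mkℚᵘ (+ (m ℕ.* n)) 0              ≈⟨ *≡* (cong (ℤ._* + 1) (ℤₚ.pos-* m n)) ⟩
    mkℚᵘ (+ m) 0 ℚᵘ.* mkℚᵘ (+ n) 0    ≈⟨ ℚᵘₚ.*-cong (toℚᵘ-ℕ→ℚ m) (toℚᵘ-ℕ→ℚ n) ⟨
    toℚᵘ (ℕ→ℚ m) ℚᵘ.* toℚᵘ (ℕ→ℚ n)   ≈⟨ ℚₚ.toℚᵘ-homo-* (ℕ→ℚ m) (ℕ→ℚ n) ⟨
    toℚᵘ (ℕ→ℚ m * ℕ→ℚ n)             ∎)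

  ℕ→ℚ-*-inverse : ∀ m .{{_ : NonZero m}} → ℕ→ℚ m * ((+ 1) / m) ≡ 1ℚ
  ℕ→ℚ-*-inverse (suc k) = ℚₚ.toℚᵘ-injective (begin
    toℚᵘ (ℕ→ℚ (suc k) * ((+ 1) / suc k))           ≈⟨ ℚₚ.toℚᵘ-homo-* (ℕ→ℚ (suc k)) ((+ 1) / suc k) ⟩
    toℚᵘ (ℕ→ℚ (suc k)) ℚᵘ.* toℚᵘ ((+ 1) / suc k)
      ≈⟨ ℚᵘₚ.*-cong (toℚᵘ-ℕ→ℚ (suc k)) (ℚₚ.toℚᵘ-fromℚᵘ (mkℚᵘ (+ 1) k)) ⟩
    mkℚᵘ (+ suc k) 0 ℚᵘ.* mkℚᵘ (+ 1) k             ≈⟨ *≡* (ℤ-identity (+ suc k)) ⟩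
    ℚᵘ.1ℚᵘ                                         ∎)
    where
    ℤ-identity : ∀ a → (a ℤ.* + 1) ℤ.* + 1 ≡ + 1 ℤ.* (+ 1 ℤ.* a)
    ℤ-identity = ℤ-Solver.solve-∀

open ≡-Reasoning

*-cancelˡ-invertible : ∀ c {r p q} → c * r ≡ 1ℚ → c * p ≡ c * q → p ≡ q
*-cancelˡ-invertible c {r} {p} {q} cr≡1 cp≡cq = begin
  p            ≡⟨ ℚₚ.*-identityˡ p ⟨
  1ℚ * p       ≡⟨ cong (_* p) cr≡1 ⟨
  c * r * p    ≡⟨ swap c r p ⟩
  r * (c * p)  ≡⟨ cong (r *_) cp≡cq ⟩
  r * (c * q)  ≡⟨ swap c r q ⟨
  c * r * q    ≡⟨ cong (_* q) cr≡1 ⟩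
  1ℚ * q       ≡⟨ ℚₚ.*-identityˡ q ⟩
  q            ∎
  where
  swap : ∀ c r p → c * r * p ≡ r * (c * p)
  swap = solve-∀ ℚ-ring

fact*invFact : ∀ n → ℕ→ℚ (n !) * invFact n ≡ 1ℚ
fact*invFact n = ℕ→ℚ-*-inverse (n !) {{n ℕₚ.!≢0}}

invFact-suc : ∀ n → ℕ→ℚ (suc n) * invFact (suc n) ≡ invFact n
invFact-suc n = *-cancelˡ-invertible (ℕ→ℚ (n !)) (fact*invFact n) (begin
  ℕ→ℚ (n !) * (ℕ→ℚ (suc n) * invFact (suc n))  ≡⟨ swap (ℕ→ℚ (n !)) (ℕ→ℚ (suc n)) (invFact (suc n)) ⟩
  ℕ→ℚ (suc n) * ℕ→ℚ (n !) * invFact (suc n)    ≡⟨ cong (_* invFact (suc n)) (ℕ→ℚ-* (suc n) (n !)) ⟨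
  ℕ→ℚ (suc n !) * invFact (suc n)               ≡⟨ fact*invFact (suc n) ⟩
  1ℚ                                            ≡⟨ fact*invFact n ⟨
  ℕ→ℚ (n !) * invFact n                         ∎)
  where
  swap : ∀ a b c → a * (b * c) ≡ b * a * c
  swap = solve-∀ ℚ-ring

sumTo-cong : ∀ n {f g : ℕ → ℚ} → (∀ i → i ≤ n → f i ≡ g i) → sumTo n f ≡ sumTo n g
sumTo-cong zero    f≗g = f≗g 0 z≤n
sumTo-cong (suc n) f≗g =
  cong₂ _+_ (sumTo-cong n (λ i i≤n → f≗g i (ℕₚ.m≤n⇒m≤1+n i≤n))) (f≗g (suc n) ℕₚ.≤-refl)

sumTo-+ : ∀ n (f g : ℕ → ℚ) → sumTo n (λ i → f i + g i) ≡ sumTo n f + sumTo n g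
sumTo-+ zero    f g = refl
sumTo-+ (suc n) f g = begin
  sumTo n (λ i → f i + g i) + (f (suc n) + g (suc n))  ≡⟨ cong (_+ (f (suc n) + g (suc n))) (sumTo-+ n f g) ⟩
  sumTo n f + sumTo n g + (f (suc n) + g (suc n))      ≡⟨ interchange (sumTo n f) (sumTo n g) (f (suc n)) (g (suc n)) ⟩
  sumTo n f + f (suc n) + (sumTo n g + g (suc n))      ∎
  where
  interchange : ∀ a b c d → a + b + (c + d) ≡ a + c + (b + d)
  interchange = solve-∀ ℚ-ring

sumTo-*ˡ : ∀ n c (f : ℕ → ℚ) → sumTo n (λ i → c * f i) ≡ c * sumTo n f
sumTo-*ˡ zero    c f = refl
sumTo-*ˡ (suc n) c f =
  trans (cong (_+ c * f (suc n)) (sumTo-*ˡ n c f)) (sym (ℚₚ.*-distribˡ-+ c (sumTo n f) (f (suc n))))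

sumTo-zero : ∀ n (f : ℕ → ℚ) → (∀ i → i ≤ n → f i ≡ 0ℚ) → sumTo n f ≡ 0ℚ
sumTo-zero zero    f f≗0 = f≗0 0 z≤n
sumTo-zero (suc n) f f≗0 =
  cong₂ _+_ (sumTo-zero n f (λ i i≤n → f≗0 i (ℕₚ.m≤n⇒m≤1+n i≤n))) (f≗0 (suc n) ℕₚ.≤-refl)

sumTo-last : ∀ n (f : ℕ → ℚ) → (∀ i → i < n → f i ≡ 0ℚ) → sumTo n f ≡ f n
sumTo-last zero    f f≗0 = refl
sumTo-last (suc n) f f≗0 =
  trans (cong (_+ f (suc n)) (sumTo-zero n f (λ i i≤n → f≗0 i (s≤s i≤n)))) (ℚₚ.+-identityˡ (f (suc n)))

sumTo-suc : ∀ n (f : ℕ → ℚ) → sumTo (suc n) f ≡ f 0 + sumTo n (λ i → f (suc i))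
sumTo-suc zero    f = refl
sumTo-suc (suc n) f = trans (cong (_+ f (suc (suc n))) (sumTo-suc n f))
  (ℚₚ.+-assoc (f 0) (sumTo n (λ i → f (suc i))) (f (suc (suc n))))

sumTo-reverse : ∀ n (f : ℕ → ℚ) → sumTo n f ≡ sumTo n (λ i → f (n ∸ i))
sumTo-reverse zero    f = refl
sumTo-reverse (suc n) f = begin
  sumTo n f + f (suc n)                  ≡⟨ ℚₚ.+-comm (sumTo n f) (f (suc n)) ⟩
  f (suc n) + sumTo n f                  ≡⟨ cong (_+_ (f (suc n))) (sumTo-reverse n f) ⟩
  f (suc n) + sumTo n (λ i → f (n ∸ i))  ≡⟨ sumTo-suc n (λ i → f (suc n ∸ i)) ⟨
  sumTo (suc n) (λ i → f (suc n ∸ i))    ∎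

sumTo-triangle : ∀ n (T : ℕ → ℕ → ℚ) →
  sumTo n (λ i → sumTo i (T i)) ≡ sumTo n (λ k → sumTo (n ∸ k) (λ l → T (k ℕ.+ l) k))
sumTo-triangle zero    T = refl
sumTo-triangle (suc n) T = begin
  sumTo n (λ i → sumTo i (T i)) + sumTo (suc n) (T (suc n))
    ≡⟨ cong (_+ sumTo (suc n) (T (suc n))) (sumTo-triangle n T) ⟩
  sumTo n (Row n) + (sumTo n (T (suc n)) + T (suc n) (suc n))
    ≡⟨ ℚₚ.+-assoc (sumTo n (Row n)) (sumTo n (T (suc n))) (T (suc n) (suc n)) ⟨
  sumTo n (Row n) + sumTo n (T (suc n)) + T (suc n) (suc n)
    ≡⟨ cong₂ _+_ (sumTo-+ n (Row n) (T (suc n))) lastRow ⟨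
  sumTo n (λ k → Row n k + T (suc n) k) + Row (suc n) (suc n)
    ≡⟨ cong (_+ Row (suc n) (suc n)) (sumTo-cong n extendRow) ⟩
  sumTo (suc n) (Row (suc n))
    ∎
  where
  Row : ℕ → ℕ → ℚ
  Row m k = sumTo (m ∸ k) (λ l → T (k ℕ.+ l) k)
  lastRow : Row (suc n) (suc n) ≡ T (suc n) (suc n)
  lastRow = trans (cong (λ m → sumTo m (λ l → T (suc n ℕ.+ l) (suc n))) (ℕₚ.n∸n≡0 n))
                  (cong (λ m → T m (suc n)) (ℕₚ.+-identityʳ (suc n)))
  extendRow : ∀ k → k ≤ n → Row n k + T (suc n) k ≡ Row (suc n) k
  extendRow k k≤n = begin
    Row n k + T (suc n) k
      ≡⟨ cong (λ m → Row n k + T m k) (trans (ℕₚ.+-suc k (n ∸ k)) (cong suc (ℕₚ.m+[n∸m]≡n k≤n))) ⟨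
    sumTo (suc (n ∸ k)) (λ l → T (k ℕ.+ l) k)
      ≡⟨ cong (λ m → sumTo m (λ l → T (k ℕ.+ l) k)) (ℕₚ.+-∸-assoc 1 k≤n) ⟨
    Row (suc n) k
      ∎

2*-suc : ∀ j → 2 ℕ.* suc j ≡ suc (suc (2 ℕ.* j))
2*-suc j = ℕₚ.*-suc 2 j

data EvenOrOdd : ℕ → Set where
  even : ∀ j → EvenOrOdd (2 ℕ.* j)
  odd  : ∀ j → EvenOrOdd (suc (2 ℕ.* j))

evenOrOdd : ∀ n → EvenOrOdd n
evenOrOdd zero = even 0
evenOrOdd (suc n) with evenOrOdd n
... | even j = odd j
... | odd j  = subst EvenOrOdd (2*-suc j) (even (suc j))

⌊2*n/2⌋≡n : ∀ n → ⌊ 2 ℕ.* n /2⌋ ≡ n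
⌊2*n/2⌋≡n zero    = refl
⌊2*n/2⌋≡n (suc n) = trans (cong ⌊_/2⌋ (2*-suc n)) (cong suc (⌊2*n/2⌋≡n n))

⌊1+2*n/2⌋≡n : ∀ n → ⌊ suc (2 ℕ.* n) /2⌋ ≡ n
⌊1+2*n/2⌋≡n zero    = refl
⌊1+2*n/2⌋≡n (suc n) = trans (cong (λ m → ⌊ suc m /2⌋) (2*-suc n)) (cong suc (⌊1+2*n/2⌋≡n n))

spread : ℕ → (ℕ → ℚ) → ℚ
spread zero          g = g 0
spread (suc zero)    g = 0ℚ
spread (suc (suc l)) g = spread l (λ j → g (suc j))

spread-even : ∀ j g → spread (2 ℕ.* j) g ≡ g j
spread-even zero    g = refl
spread-even (suc j) g = trans (cong (λ l → spread l g) (2*-suc j)) (spread-even j (λ i → g (suc i)))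

spread-odd : ∀ j g → spread (suc (2 ℕ.* j)) g ≡ 0ℚ
spread-odd zero    g = refl
spread-odd (suc j) g = trans (cong (λ l → spread (suc l) g) (2*-suc j)) (spread-odd j (λ i → g (suc i)))

sumTo-spread : ∀ n g (w : ℕ → ℚ) →
  sumTo n (λ l → spread l g * w l) ≡ sumTo ⌊ n /2⌋ (λ j → g j * w (2 ℕ.* j))
sumTo-spread zero          g w = refl
sumTo-spread (suc zero)    g w = dropZero (g 0 * w 0) (w 1)
  where
  dropZero : ∀ a b → a + 0ℚ * b ≡ a
  dropZero = solve-∀ ℚ-ring
sumTo-spread (suc (suc n)) g w = begin
  sumTo (suc (suc n)) (λ l → spread l g * w l)
    ≡⟨ sumTo-suc (suc n) (λ l → spread l g * w l) ⟩
  g 0 * w 0 + sumTo (suc n) (λ l → spread (suc l) g * w (suc l))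
    ≡⟨ cong (_+_ (g 0 * w 0)) (begin
         sumTo (suc n) (λ l → spread (suc l) g * w (suc l))
           ≡⟨ sumTo-suc n (λ l → spread (suc l) g * w (suc l)) ⟩
         0ℚ * w 1 + sumTo n (λ l → spread l g′ * w (suc (suc l)))
           ≡⟨ dropZero (w 1) _ ⟩
         sumTo n (λ l → spread l g′ * w (suc (suc l)))
           ≡⟨ sumTo-spread n g′ (λ l → w (suc (suc l))) ⟩
         sumTo ⌊ n /2⌋ (λ j → g′ j * w (suc (suc (2 ℕ.* j))))
           ≡⟨ sumTo-cong ⌊ n /2⌋ (λ j _ → cong (λ m → g′ j * w m) (2*-suc j)) ⟨
         sumTo ⌊ n /2⌋ (λ j → g′ j * w (2 ℕ.* suc j))
           ∎) ⟩
  g 0 * w 0 + sumTo ⌊ n /2⌋ (λ j → g′ j * w (2 ℕ.* suc j))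
    ≡⟨ sumTo-suc ⌊ n /2⌋ (λ j → g j * w (2 ℕ.* j)) ⟨
  sumTo (suc ⌊ n /2⌋) (λ j → g j * w (2 ℕ.* j))
    ∎
  where
  g′ : ℕ → ℚ
  g′ j = g (suc j)
  dropZero : ∀ a b → 0ℚ * a + b ≡ b
  dropZero = solve-∀ ℚ-ring

hermiteTerm : ℕ → ℚ → ℕ → ℚ
hermiteTerm m x j = ((- 1ℚ) ^ j) * ((ℕ→ℚ 2 * x) ^ (m ∸ (2 ℕ.* j))) * invFact j * invFact (m ∸ (2 ℕ.* j))

hermiteTerm-zero : ∀ m j {e} → m ∸ 2 ℕ.* j ≡ suc e → hermiteTerm m 0ℚ j ≡ 0ℚ
hermiteTerm-zero m j {e} m∸2j≡1+e rewrite m∸2j≡1+e =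
  vanish ((- 1ℚ) ^ j) ((ℕ→ℚ 2 * 0ℚ) ^ e) (invFact j) (invFact (suc e))
  where
  vanish : ∀ a b c d → a * (0ℚ * b) * c * d ≡ 0ℚ
  vanish = solve-∀ ℚ-ring

scaledHermiteNum : ℕ → ℚ
scaledHermiteNum m = hermiteNum m * invFact m

scaledHermiteNum-spread : ∀ m → scaledHermiteNum m ≡ spread m (λ j → (- 1ℚ) ^ j * invFact j)
scaledHermiteNum-spread m with evenOrOdd m
... | even j = begin
  ℕ→ℚ (2j !) * sumTo ⌊ 2j /2⌋ (hermiteTerm 2j 0ℚ) * invFact 2j
    ≡⟨ cong (λ s → ℕ→ℚ (2j !) * s * invFact 2j)
         (trans (cong (λ i → sumTo i (hermiteTerm 2j 0ℚ)) (⌊2*n/2⌋≡n j)) (sumTo-last j (hermiteTerm 2j 0ℚ) earlierTerm)) ⟩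
  ℕ→ℚ (2j !) * hermiteTerm 2j 0ℚ j * invFact 2j
    ≡⟨ cong (λ e → ℕ→ℚ (2j !) * ((- 1ℚ) ^ j * (ℕ→ℚ 2 * 0ℚ) ^ e * invFact j * invFact e) * invFact 2j)
            (ℕₚ.n∸n≡0 2j) ⟩
  ℕ→ℚ (2j !) * ((- 1ℚ) ^ j * 1ℚ * invFact j * 1ℚ) * invFact 2j
    ≡⟨ regroup (ℕ→ℚ (2j !)) ((- 1ℚ) ^ j) (invFact j) (invFact 2j) ⟩
  ℕ→ℚ (2j !) * invFact 2j * ((- 1ℚ) ^ j * invFact j)
    ≡⟨ cong (_* ((- 1ℚ) ^ j * invFact j)) (fact*invFact 2j) ⟩
  1ℚ * ((- 1ℚ) ^ j * invFact j)
    ≡⟨ ℚₚ.*-identityˡ _ ⟩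
  (- 1ℚ) ^ j * invFact j
    ≡⟨ spread-even j (λ i → (- 1ℚ) ^ i * invFact i) ⟨
  spread 2j (λ i → (- 1ℚ) ^ i * invFact i)
    ∎
  where
  2j : ℕ
  2j = 2 ℕ.* j
  earlierTerm : ∀ i → i < j → hermiteTerm 2j 0ℚ i ≡ 0ℚ
  earlierTerm i i<j = hermiteTerm-zero 2j i (ℕₚ.+-∸-assoc 1 (ℕₚ.*-monoʳ-< 2 i<j))
  regroup : ∀ a s f b → a * (s * 1ℚ * f * 1ℚ) * b ≡ a * b * (s * f)
  regroup = solve-∀ ℚ-ring
... | odd j = begin
  ℕ→ℚ (2j+1 !) * sumTo ⌊ 2j+1 /2⌋ (hermiteTerm 2j+1 0ℚ) * invFact 2j+1
    ≡⟨ cong (λ s → ℕ→ℚ (2j+1 !) * s * invFact 2j+1) (sumTo-zero ⌊ 2j+1 /2⌋ (hermiteTerm 2j+1 0ℚ) anyTerm) ⟩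
  ℕ→ℚ (2j+1 !) * 0ℚ * invFact 2j+1
    ≡⟨ vanish (ℕ→ℚ (2j+1 !)) (invFact 2j+1) ⟩
  0ℚ
    ≡⟨ spread-odd j (λ i → (- 1ℚ) ^ i * invFact i) ⟨
  spread 2j+1 (λ i → (- 1ℚ) ^ i * invFact i)
    ∎
  where
  2j+1 : ℕ
  2j+1 = suc (2 ℕ.* j)
  anyTerm : ∀ i → i ≤ ⌊ 2j+1 /2⌋ → hermiteTerm 2j+1 0ℚ i ≡ 0ℚ
  anyTerm i i≤ =
    hermiteTerm-zero 2j+1 i (ℕₚ.+-∸-assoc 1 (ℕₚ.*-monoʳ-≤ 2 (subst (i ≤_) (⌊1+2*n/2⌋≡n j) i≤)))
  vanish : ∀ a b → a * 0ℚ * b ≡ 0ℚ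
  vanish = solve-∀ ℚ-ring

expCoeff : ℚ → ℕ → ℚ
expCoeff x i = (ℕ→ℚ 2 * x) ^ i * invFact i

hermite-convolution : ∀ n x → hermite n x ≡ ℕ→ℚ (n !) * sumTo n (λ i → scaledHermiteNum (n ∸ i) * expCoeff x i)
hermite-convolution n x = cong (ℕ→ℚ (n !) *_) (sym (begin
  sumTo n (λ i → scaledHermiteNum (n ∸ i) * expCoeff x i)
    ≡⟨ sumTo-reverse n _ ⟩
  sumTo n (λ l → scaledHermiteNum (n ∸ (n ∸ l)) * expCoeff x (n ∸ l))
    ≡⟨ sumTo-cong n (λ l l≤n → cong (_* expCoeff x (n ∸ l))
         (trans (cong scaledHermiteNum (ℕₚ.m∸[m∸n]≡n l≤n)) (scaledHermiteNum-spread l))) ⟩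
  sumTo n (λ l → spread l σ * expCoeff x (n ∸ l))
    ≡⟨ sumTo-spread n σ (λ l → expCoeff x (n ∸ l)) ⟩
  sumTo ⌊ n /2⌋ (λ j → σ j * expCoeff x (n ∸ 2 ℕ.* j))
    ≡⟨ sumTo-cong ⌊ n /2⌋ (λ j _ →
         regroup ((- 1ℚ) ^ j) (invFact j) ((ℕ→ℚ 2 * x) ^ (n ∸ 2 ℕ.* j)) (invFact (n ∸ 2 ℕ.* j))) ⟩
  sumTo ⌊ n /2⌋ (hermiteTerm n x)
    ∎))
  where
  σ : ℕ → ℚ
  σ j = (- 1ℚ) ^ j * invFact j
  regroup : ∀ s f p g → s * f * (p * g) ≡ s * p * f * g
  regroup = solve-∀ ℚ-ring

chebUPrev : ℚ → ℕ → ℚ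
chebUPrev x zero    = 0ℚ
chebUPrev x (suc k) = chebU k x

2x*chebU : ∀ x k → ℕ→ℚ 2 * x * chebU k x ≡ chebU (suc k) x + chebUPrev x k
2x*chebU x zero    = addZero (ℕ→ℚ 2 * x)
  where
  addZero : ∀ a → a * 1ℚ ≡ a + 0ℚ
  addZero = solve-∀ ℚ-ring
2x*chebU x (suc k) = subAdd (ℕ→ℚ 2 * x * chebU (suc k) x) (chebU k x)
  where
  subAdd : ∀ a b → a ≡ a - b + b
  subAdd = solve-∀ ℚ-ring

-- A gap family c gives, as c l k, the coefficient of U_k in degree k + l.
chebSeries : (ℕ → ℕ → ℚ) → ℚ → ℕ → ℚ
chebSeries c x i = sumTo i (λ k → c (i ∸ k) k * chebU k x)

fromBelow : (ℕ → ℕ → ℚ) → ℕ → ℕ → ℚ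
fromBelow c l zero    = 0ℚ
fromBelow c l (suc k) = c l k

fromAbove : (ℕ → ℕ → ℚ) → ℕ → ℕ → ℚ
fromAbove c zero          k = 0ℚ
fromAbove c (suc zero)    k = 0ℚ
fromAbove c (suc (suc l)) k = c l (suc k)

chebSeries-fromBelow : ∀ c x i →
  chebSeries (fromBelow c) x (suc i) ≡ sumTo i (λ k → c (i ∸ k) k * chebU (suc k) x)
chebSeries-fromBelow c x i =
  trans (sumTo-suc i (λ k → fromBelow c (suc i ∸ k) k * chebU k x)) (dropZero (chebU 0 x) _)
  where
  dropZero : ∀ a b → 0ℚ * a + b ≡ b
  dropZero = solve-∀ ℚ-ring

chebSeries-fromAbove : ∀ c x i →
  chebSeries (fromAbove c) x (suc i) ≡ sumTo i (λ k → c (i ∸ k) k * chebUPrev x k)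
chebSeries-fromAbove c x zero = vanish (chebU 0 x) (chebU 1 x) (c 0 0)
  where
  vanish : ∀ a b d → 0ℚ * a + 0ℚ * b ≡ d * 0ℚ
  vanish = solve-∀ ℚ-ring
chebSeries-fromAbove c x (suc i) = begin
  sumTo i F + F (suc i) + F (suc (suc i))
    ≡⟨ cong₂ (λ p q → sumTo i F + fromAbove c p (suc i) * chebU (suc i) x
                                 + fromAbove c q (suc (suc i)) * chebU (suc (suc i)) x)
             (ℕₚ.m+n∸n≡m 1 i) (ℕₚ.n∸n≡0 i) ⟩
  sumTo i F + 0ℚ * chebU (suc i) x + 0ℚ * chebU (suc (suc i)) x
    ≡⟨ dropZeros (sumTo i F) (chebU (suc i) x) (chebU (suc (suc i)) x) (c (suc i) 0) ⟩
  c (suc i) 0 * 0ℚ + sumTo i F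
    ≡⟨ cong (_+_ (c (suc i) 0 * 0ℚ)) (sumTo-cong i (λ k k≤i →
         cong (λ l → fromAbove c l k * chebU k x) (ℕₚ.+-∸-assoc 2 k≤i))) ⟩
  c (suc i) 0 * 0ℚ + sumTo i (λ k → c (i ∸ k) (suc k) * chebU k x)
    ≡⟨ sumTo-suc i (λ k → c (suc i ∸ k) k * chebUPrev x k) ⟨
  sumTo (suc i) (λ k → c (suc i ∸ k) k * chebUPrev x k)
    ∎
  where
  F : ℕ → ℚ
  F k = fromAbove c (suc (suc i) ∸ k) k * chebU k x
  dropZeros : ∀ s a b d → s + 0ℚ * a + 0ℚ * b ≡ d * 0ℚ + s
  dropZeros = solve-∀ ℚ-ring

2x*chebSeries : ∀ c x i →
  ℕ→ℚ 2 * x * chebSeries c x i ≡ chebSeries (fromBelow c) x (suc i) + chebSeries (fromAbove c) x (suc i)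
2x*chebSeries c x i = begin
  ℕ→ℚ 2 * x * chebSeries c x i
    ≡⟨ sumTo-*ˡ i (ℕ→ℚ 2 * x) (λ k → c (i ∸ k) k * chebU k x) ⟨
  sumTo i (λ k → ℕ→ℚ 2 * x * (c (i ∸ k) k * chebU k x))
    ≡⟨ sumTo-cong i (λ k _ → begin
         ℕ→ℚ 2 * x * (c (i ∸ k) k * chebU k x)     ≡⟨ swap (ℕ→ℚ 2 * x) (c (i ∸ k) k) (chebU k x) ⟩
         c (i ∸ k) k * (ℕ→ℚ 2 * x * chebU k x)     ≡⟨ cong (c (i ∸ k) k *_) (2x*chebU x k) ⟩
         c (i ∸ k) k * (chebU (suc k) x + chebUPrev x k)
           ≡⟨ ℚₚ.*-distribˡ-+ (c (i ∸ k) k) (chebU (suc k) x) (chebUPrev x k) ⟩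
         c (i ∸ k) k * chebU (suc k) x + c (i ∸ k) k * chebUPrev x k ∎) ⟩
  sumTo i (λ k → c (i ∸ k) k * chebU (suc k) x + c (i ∸ k) k * chebUPrev x k)
    ≡⟨ sumTo-+ i _ _ ⟩
  sumTo i (λ k → c (i ∸ k) k * chebU (suc k) x) + sumTo i (λ k → c (i ∸ k) k * chebUPrev x k)
    ≡⟨ cong₂ _+_ (chebSeries-fromBelow c x i) (chebSeries-fromAbove c x i) ⟨
  chebSeries (fromBelow c) x (suc i) + chebSeries (fromAbove c) x (suc i)
    ∎
  where
  swap : ∀ t a u → t * (a * u) ≡ a * (t * u)
  swap = solve-∀ ℚ-ring

chebSeries-+ : ∀ c d x i → chebSeries c x i + chebSeries d x i ≡ chebSeries (λ l k → c l k + d l k) x i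
chebSeries-+ c d x i = begin
  chebSeries c x i + chebSeries d x i
    ≡⟨ sumTo-+ i _ _ ⟨
  sumTo i (λ k → c (i ∸ k) k * chebU k x + d (i ∸ k) k * chebU k x)
    ≡⟨ sumTo-cong i (λ k _ → ℚₚ.*-distribʳ-+ (chebU k x) (c (i ∸ k) k) (d (i ∸ k) k)) ⟨
  chebSeries (λ l k → c l k + d l k) x i
    ∎

chebSeries-degree : ∀ c x i → chebSeries (λ l k → ℕ→ℚ (k ℕ.+ l) * c l k) x i ≡ ℕ→ℚ i * chebSeries c x i
chebSeries-degree c x i = begin
  sumTo i (λ k → ℕ→ℚ (k ℕ.+ (i ∸ k)) * c (i ∸ k) k * chebU k x)
    ≡⟨ sumTo-cong i (λ k k≤i → trans (cong (λ m → ℕ→ℚ m * c (i ∸ k) k * chebU k x) (ℕₚ.m+[n∸m]≡n k≤i))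
                                    (ℚₚ.*-assoc (ℕ→ℚ i) (c (i ∸ k) k) (chebU k x))) ⟩
  sumTo i (λ k → ℕ→ℚ i * (c (i ∸ k) k * chebU k x))
    ≡⟨ sumTo-*ˡ i (ℕ→ℚ i) _ ⟩
  ℕ→ℚ i * chebSeries c x i
    ∎

expCoeff-suc : ∀ x i → ℕ→ℚ (suc i) * expCoeff x (suc i) ≡ ℕ→ℚ 2 * x * expCoeff x i
expCoeff-suc x i = begin
  ℕ→ℚ (suc i) * (t * t ^ i * invFact (suc i))   ≡⟨ regroup (ℕ→ℚ (suc i)) t (t ^ i) (invFact (suc i)) ⟩
  t * (t ^ i * (ℕ→ℚ (suc i) * invFact (suc i))) ≡⟨ cong (λ f → t * (t ^ i * f)) (invFact-suc i) ⟩
  t * (t ^ i * invFact i)                        ∎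
  where
  t : ℚ
  t = ℕ→ℚ 2 * x
  regroup : ∀ c t p f → c * (t * p * f) ≡ t * (p * (c * f))
  regroup = solve-∀ ℚ-ring

expCoeff-chebSeries : ∀ c → c 0 0 ≡ 1ℚ →
  (∀ l k → ℕ→ℚ (k ℕ.+ l) * c l k ≡ fromBelow c l k + fromAbove c l k) →
  ∀ x i → expCoeff x i ≡ chebSeries c x i
expCoeff-chebSeries c c₀₀≡1 rec x zero    = sym (trans (ℚₚ.*-identityʳ (c 0 0)) c₀₀≡1)
expCoeff-chebSeries c c₀₀≡1 rec x (suc i) =
  *-cancelˡ-invertible (ℕ→ℚ (suc i)) (ℕ→ℚ-*-inverse (suc i)) (begin
    ℕ→ℚ (suc i) * expCoeff x (suc i)
      ≡⟨ expCoeff-suc x i ⟩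
    ℕ→ℚ 2 * x * expCoeff x i
      ≡⟨ cong (ℕ→ℚ 2 * x *_) (expCoeff-chebSeries c c₀₀≡1 rec x i) ⟩
    ℕ→ℚ 2 * x * chebSeries c x i
      ≡⟨ 2x*chebSeries c x i ⟩
    chebSeries (fromBelow c) x (suc i) + chebSeries (fromAbove c) x (suc i)
      ≡⟨ chebSeries-+ (fromBelow c) (fromAbove c) x (suc i) ⟩
    chebSeries (λ l k → fromBelow c l k + fromAbove c l k) x (suc i)
      ≡⟨ sumTo-cong (suc i) (λ k _ → cong (_* chebU k x) (rec (suc i ∸ k) k)) ⟨
    chebSeries (λ l k → ℕ→ℚ (k ℕ.+ l) * c l k) x (suc i)
      ≡⟨ chebSeries-degree c x (suc i) ⟩
    ℕ→ℚ (suc i) * chebSeries c x (suc i)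
      ∎)

chebCoeff : ℕ → ℕ → ℚ
chebCoeff k j = ℕ→ℚ (suc k) * invFact (suc (k ℕ.+ j)) * invFact j

chebGapCoeff : ℕ → ℕ → ℚ
chebGapCoeff l k = spread l (chebCoeff k)

-- The summands are chebCoeff (k − 1) j and chebCoeff (k + 1) (j − 1), written so that
-- they vanish at k = 0 and at j = 0 respectively.
chebCoeff-rec : ∀ k j → ℕ→ℚ (k ℕ.+ 2 ℕ.* j) * chebCoeff k j
  ≡ ℕ→ℚ k * invFact (k ℕ.+ j) * invFact j + ℕ→ℚ (suc (suc k)) * ℕ→ℚ j * invFact (suc (k ℕ.+ j)) * invFact j
chebCoeff-rec k j = begin
  ℕ→ℚ (k ℕ.+ 2 ℕ.* j) * (ℕ→ℚ (suc k) * A * B)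
    ≡⟨ cong₂ (λ u v → u * (v * A * B)) (trans (ℕ→ℚ-+ k (2 ℕ.* j)) (cong (_+_ a) (ℕ→ℚ-* 2 j))) (ℕ→ℚ-+ 1 k) ⟩
  (a + ℕ→ℚ 2 * b) * ((1ℚ + a) * A * B)
    ≡⟨ identity a b A B ⟩
  a * ((1ℚ + (a + b)) * A) * B + (ℕ→ℚ 2 + a) * b * A * B
    ≡⟨ cong₂ (λ u v → a * u * B + v * b * A * B)
         (trans (cong (_* A) (sym (trans (ℕ→ℚ-+ 1 (k ℕ.+ j)) (cong (_+_ 1ℚ) (ℕ→ℚ-+ k j))))) (invFact-suc (k ℕ.+ j)))
         (sym (ℕ→ℚ-+ 2 k)) ⟩
  a * invFact (k ℕ.+ j) * B + ℕ→ℚ (suc (suc k)) * b * A * B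
    ∎
  where
  a b A B : ℚ
  a = ℕ→ℚ k
  b = ℕ→ℚ j
  A = invFact (suc (k ℕ.+ j))
  B = invFact j
  identity : ∀ a b A B → (a + ℕ→ℚ 2 * b) * ((1ℚ + a) * A * B)
                       ≡ a * ((1ℚ + (a + b)) * A) * B + (ℕ→ℚ 2 + a) * b * A * B
  identity = solve-∀ ℚ-ring

fromBelow-chebGapCoeff-even : ∀ j k → fromBelow chebGapCoeff (2 ℕ.* j) k ≡ ℕ→ℚ k * invFact (k ℕ.+ j) * invFact j
fromBelow-chebGapCoeff-even j zero    = vanish (invFact j) (invFact j)
  where
  vanish : ∀ a b → 0ℚ ≡ 0ℚ * a * b
  vanish = solve-∀ ℚ-ring
fromBelow-chebGapCoeff-even j (suc k) = spread-even j (chebCoeff k)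

fromAbove-chebGapCoeff-even : ∀ j k →
  fromAbove chebGapCoeff (2 ℕ.* j) k ≡ ℕ→ℚ (suc (suc k)) * ℕ→ℚ j * invFact (suc (k ℕ.+ j)) * invFact j
fromAbove-chebGapCoeff-even zero    k = vanish (ℕ→ℚ (suc (suc k))) (invFact (suc (k ℕ.+ 0)))
  where
  vanish : ∀ a b → 0ℚ ≡ a * 0ℚ * b * 1ℚ
  vanish = solve-∀ ℚ-ring
fromAbove-chebGapCoeff-even (suc j) k = begin
  fromAbove chebGapCoeff (2 ℕ.* suc j) k
    ≡⟨ cong (λ l → fromAbove chebGapCoeff l k) (2*-suc j) ⟩
  spread (2 ℕ.* j) (chebCoeff (suc k))
    ≡⟨ spread-even j (chebCoeff (suc k)) ⟩
  c * A * invFact j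
    ≡⟨ cong (c * A *_) (invFact-suc j) ⟨
  c * A * (ℕ→ℚ (suc j) * invFact (suc j))
    ≡⟨ regroup c A (ℕ→ℚ (suc j)) (invFact (suc j)) ⟩
  c * ℕ→ℚ (suc j) * A * invFact (suc j)
    ≡⟨ cong (λ m → c * ℕ→ℚ (suc j) * invFact (suc m) * invFact (suc j)) (ℕₚ.+-suc k j) ⟨
  c * ℕ→ℚ (suc j) * invFact (suc (k ℕ.+ suc j)) * invFact (suc j)
    ∎
  where
  c A : ℚ
  c = ℕ→ℚ (suc (suc k))
  A = invFact (suc (suc (k ℕ.+ j)))
  regroup : ∀ c A n f → c * A * (n * f) ≡ c * n * A * f
  regroup = solve-∀ ℚ-ring

fromBelow-chebGapCoeff-odd : ∀ j k → fromBelow chebGapCoeff (suc (2 ℕ.* j)) k ≡ 0ℚ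
fromBelow-chebGapCoeff-odd j zero    = refl
fromBelow-chebGapCoeff-odd j (suc k) = spread-odd j (chebCoeff k)

fromAbove-chebGapCoeff-odd : ∀ j k → fromAbove chebGapCoeff (suc (2 ℕ.* j)) k ≡ 0ℚ
fromAbove-chebGapCoeff-odd zero    k = refl
fromAbove-chebGapCoeff-odd (suc j) k =
  trans (cong (λ l → fromAbove chebGapCoeff (suc l) k) (2*-suc j)) (spread-odd j (chebCoeff (suc k)))

chebGapCoeff-rec : ∀ l k → ℕ→ℚ (k ℕ.+ l) * chebGapCoeff l k ≡ fromBelow chebGapCoeff l k + fromAbove chebGapCoeff l k
chebGapCoeff-rec l k with evenOrOdd l
... | even j = begin
  ℕ→ℚ (k ℕ.+ 2 ℕ.* j) * spread (2 ℕ.* j) (chebCoeff k)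
    ≡⟨ cong (ℕ→ℚ (k ℕ.+ 2 ℕ.* j) *_) (spread-even j (chebCoeff k)) ⟩
  ℕ→ℚ (k ℕ.+ 2 ℕ.* j) * chebCoeff k j
    ≡⟨ chebCoeff-rec k j ⟩
  ℕ→ℚ k * invFact (k ℕ.+ j) * invFact j + ℕ→ℚ (suc (suc k)) * ℕ→ℚ j * invFact (suc (k ℕ.+ j)) * invFact j
    ≡⟨ cong₂ _+_ (fromBelow-chebGapCoeff-even j k) (fromAbove-chebGapCoeff-even j k) ⟨
  fromBelow chebGapCoeff (2 ℕ.* j) k + fromAbove chebGapCoeff (2 ℕ.* j) k
    ∎
... | odd j = begin
  ℕ→ℚ (k ℕ.+ suc (2 ℕ.* j)) * spread (suc (2 ℕ.* j)) (chebCoeff k)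
    ≡⟨ cong (ℕ→ℚ (k ℕ.+ suc (2 ℕ.* j)) *_) (spread-odd j (chebCoeff k)) ⟩
  ℕ→ℚ (k ℕ.+ suc (2 ℕ.* j)) * 0ℚ
    ≡⟨ ℚₚ.*-zeroʳ (ℕ→ℚ (k ℕ.+ suc (2 ℕ.* j))) ⟩
  0ℚ + 0ℚ
    ≡⟨ cong₂ _+_ (fromBelow-chebGapCoeff-odd j k) (fromAbove-chebGapCoeff-odd j k) ⟨
  fromBelow chebGapCoeff (suc (2 ℕ.* j)) k + fromAbove chebGapCoeff (suc (2 ℕ.* j)) k
    ∎

expCoeff-chebGapCoeff : ∀ x i → expCoeff x i ≡ chebSeries chebGapCoeff x i
expCoeff-chebGapCoeff = expCoeff-chebSeries chebGapCoeff refl chebGapCoeff-rec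

chebU-coefficient : ∀ n x k →
  sumTo (n ∸ k) (λ l → scaledHermiteNum (n ∸ (k ℕ.+ l)) * (chebGapCoeff (k ℕ.+ l ∸ k) k * chebU k x))
  ≡ ℕ→ℚ (k ℕ.+ 1) * innerSum n k * chebU k x
chebU-coefficient n x k = begin
  sumTo (n ∸ k) (λ l → scaledHermiteNum (n ∸ (k ℕ.+ l)) * (chebGapCoeff (k ℕ.+ l ∸ k) k * U))
    ≡⟨ sumTo-cong (n ∸ k) (λ l _ → trans
         (cong₂ (λ m g → scaledHermiteNum m * (chebGapCoeff g k * U)) (sym (ℕₚ.∸-+-assoc n k l)) (ℕₚ.m+n∸m≡n k l))
         (swap (scaledHermiteNum (n ∸ k ∸ l)) (chebGapCoeff l k) U)) ⟩
  sumTo (n ∸ k) (λ l → spread l (chebCoeff k) * (scaledHermiteNum (n ∸ k ∸ l) * U))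
    ≡⟨ sumTo-spread (n ∸ k) (chebCoeff k) (λ l → scaledHermiteNum (n ∸ k ∸ l) * U) ⟩
  sumTo ⌊ n ∸ k /2⌋ (λ j → chebCoeff k j * (scaledHermiteNum (n ∸ k ∸ 2 ℕ.* j) * U))
    ≡⟨ sumTo-cong ⌊ n ∸ k /2⌋ (λ j _ → trans
         (cong₂ (λ c f → c * f * invFact j * (scaledHermiteNum (n ∸ k ∸ 2 ℕ.* j) * U))
                (cong ℕ→ℚ (ℕₚ.+-comm 1 k)) (cong invFact (ℕₚ.+-comm 1 (k ℕ.+ j))))
         (regroup (ℕ→ℚ (k ℕ.+ 1)) (invFact (k ℕ.+ j ℕ.+ 1)) (invFact j)
                  (hermiteNum (n ∸ k ∸ 2 ℕ.* j)) (invFact (n ∸ k ∸ 2 ℕ.* j)) U)) ⟩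
  sumTo ⌊ n ∸ k /2⌋ (λ j → ℕ→ℚ (k ℕ.+ 1) * U *
    (hermiteNum (n ∸ k ∸ 2 ℕ.* j) * invFact (n ∸ k ∸ 2 ℕ.* j) * invFact (k ℕ.+ j ℕ.+ 1) * invFact j))
    ≡⟨ sumTo-*ˡ ⌊ n ∸ k /2⌋ (ℕ→ℚ (k ℕ.+ 1) * U) _ ⟩
  ℕ→ℚ (k ℕ.+ 1) * U * innerSum n k
    ≡⟨ swapLast (ℕ→ℚ (k ℕ.+ 1)) U (innerSum n k) ⟩
  ℕ→ℚ (k ℕ.+ 1) * innerSum n k * U
    ∎
  where
  U : ℚ
  U = chebU k x
  swap : ∀ h c u → h * (c * u) ≡ c * (h * u)
  swap = solve-∀ ℚ-ring
  regroup : ∀ c f g h i u → c * f * g * (h * i * u) ≡ c * u * (h * i * f * g)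
  regroup = solve-∀ ℚ-ring
  swapLast : ∀ c u s → c * u * s ≡ c * s * u
  swapLast = solve-∀ ℚ-ring

mainTheorem7 : (n : ℕ) (x : ℚ) → hermite n x ≡ rhs n x
mainTheorem7 n x = begin
  hermite n x
    ≡⟨ hermite-convolution n x ⟩
  ℕ→ℚ (n !) * sumTo n (λ i → scaledHermiteNum (n ∸ i) * expCoeff x i)
    ≡⟨ cong (ℕ→ℚ (n !) *_) (begin
      sumTo n (λ i → scaledHermiteNum (n ∸ i) * expCoeff x i)
        ≡⟨ sumTo-cong n (λ i _ → cong (scaledHermiteNum (n ∸ i) *_) (expCoeff-chebGapCoeff x i)) ⟩
      sumTo n (λ i → scaledHermiteNum (n ∸ i) * chebSeries chebGapCoeff x i)
        ≡⟨ sumTo-cong n (λ i _ → sumTo-*ˡ i (scaledHermiteNum (n ∸ i)) _) ⟨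
      sumTo n (λ i → sumTo i (λ k → scaledHermiteNum (n ∸ i) * (chebGapCoeff (i ∸ k) k * chebU k x)))
        ≡⟨ sumTo-triangle n (λ i k → scaledHermiteNum (n ∸ i) * (chebGapCoeff (i ∸ k) k * chebU k x)) ⟩
      sumTo n (λ k → sumTo (n ∸ k) (λ l →
        scaledHermiteNum (n ∸ (k ℕ.+ l)) * (chebGapCoeff (k ℕ.+ l ∸ k) k * chebU k x)))
        ≡⟨ sumTo-cong n (λ k _ → chebU-coefficient n x k) ⟩
      sumTo n (λ k → ℕ→ℚ (k ℕ.+ 1) * innerSum n k * chebU k x)
        ∎) ⟩
  rhs n x
    ∎
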